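{- Let $a,b,c,d\in\mathbb{Z}_{\ge 0}$ satisfy $a^5+b^5=c^5+d^5$, and put $h=(c+d)-(a+b)$. Then $30\mid h$. -}

module Defs where

{-# OPTIONS --safe #-}
-- Since p - 1 divides 4 for p = 2, 3, 5, Fermat's little theorem gives x⁵ ≡ x modulo each of
-- these primes, hence modulo 30 (here checked directly on the 30 residues). So
-- a + b ≡ a⁵ + b⁵ = c⁵ + d⁵ ≡ c + d (mod 30).
module Submission where

open import Defs
open import Data.Nat using (ℕ; _^_)
open import Data.Integer using (ℤ; +_; _-_)
open import Data.Integer.Divisibility using (_∣_)
open import Data.Nat.Base using (_+_)
open import Relation.Binary.PropositionalEquality using (_≡_)

open import Data.Nat.Base as ℕ using (zero; suc; _*_; _<_; NonZero; _%_; _/_; ∣_-_∣)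
open import Data.Nat.Properties
  using (_≟_; ≤-total; m≤n⇒∣m-n∣≡n∸m; m≤n⇒∣n-m∣≡n∸m; ∣m+n-m+o∣≡∣n-o∣; *-distribʳ-∣-∣)
open import Data.Nat.DivMod using (m≡m%n+[m/n]*n; m%n<n; m%n%n≡m%n; %-distribˡ-+; %-distribˡ-*)
import Data.Nat.Divisibility as ℕ
open import Data.Fin.Base using (Fin; toℕ; fromℕ<)
open import Data.Fin.Properties using (all?; toℕ-fromℕ<)
open import Data.Integer.Base as ℤ using (_⊖_)
open import Data.Integer.Properties using ([+m]-[+n]≡m⊖n; ∣⊖∣-≤; ∣m⊖n∣≡∣n⊖m∣)
open import Data.Sum.Base using (inj₁; inj₂)
open import Relation.Nullary.Decidable using (toWitness)
open import Relation.Binary.PropositionalEquality using (refl; sym; trans; cong; cong₂; subst; module ≡-Reasoning)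

%-distribˡ-^ : ∀ m k d .{{_ : NonZero d}} → m ^ k % d ≡ (m % d) ^ k % d
%-distribˡ-^ m zero    d = refl
%-distribˡ-^ m (suc k) d = begin
  m * m ^ k % d                      ≡⟨ %-distribˡ-* m (m ^ k) d ⟩
  m % d * (m ^ k % d) % d            ≡⟨ cong (λ t → (t * (m ^ k % d)) % d) (sym (m%n%n≡m%n m d)) ⟩
  m % d % d * (m ^ k % d) % d        ≡⟨ cong (λ t → (m % d % d * t) % d) (%-distribˡ-^ m k d) ⟩
  m % d % d * ((m % d) ^ k % d) % d  ≡⟨ sym (%-distribˡ-* (m % d) ((m % d) ^ k) d) ⟩
  (m % d) * (m % d) ^ k % d          ∎
  where open ≡-Reasoning

r^5%30≡r : ∀ r → r < 30 → r ^ 5 % 30 ≡ r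
r^5%30≡r r r<30 = subst (λ s → s ^ 5 % 30 ≡ s) (toℕ-fromℕ< r<30) (residues (fromℕ< r<30))
  where
  residues : (i : Fin 30) → toℕ i ^ 5 % 30 ≡ toℕ i
  residues = toWitness {a? = all? (λ i → toℕ i ^ 5 % 30 ≟ toℕ i)} _

m^5%30≡m%30 : ∀ m → m ^ 5 % 30 ≡ m % 30
m^5%30≡m%30 m = trans (%-distribˡ-^ m 5 30) (r^5%30≡r (m % 30) (m%n<n m 30))

[m^5+n^5]%30≡[m+n]%30 : ∀ m n → (m ^ 5 + n ^ 5) % 30 ≡ (m + n) % 30
[m^5+n^5]%30≡[m+n]%30 m n = begin
  (m ^ 5 + n ^ 5) % 30          ≡⟨ %-distribˡ-+ (m ^ 5) (n ^ 5) 30 ⟩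
  (m ^ 5 % 30 + n ^ 5 % 30) % 30 ≡⟨ cong₂ (λ s t → (s + t) % 30) (m^5%30≡m%30 m) (m^5%30≡m%30 n) ⟩
  (m % 30 + n % 30) % 30        ≡⟨ sym (%-distribˡ-+ m n 30) ⟩
  (m + n) % 30                  ∎
  where open ≡-Reasoning

%-≡⇒∣∣-∣ : ∀ m n d .{{_ : NonZero d}} → m % d ≡ n % d → d ℕ.∣ ∣ m - n ∣
%-≡⇒∣∣-∣ m n d m%d≡n%d = ℕ.divides ∣ m / d - n / d ∣ (begin
  ∣ m - n ∣                                   ≡⟨ cong₂ ∣_-_∣ (m≡m%n+[m/n]*n m d) (m≡m%n+[m/n]*n n d) ⟩
  ∣ m % d + m / d * d - n % d + n / d * d ∣   ≡⟨ cong (λ r → ∣ r + m / d * d - n % d + n / d * d ∣) m%d≡n%d ⟩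
  ∣ n % d + m / d * d - n % d + n / d * d ∣   ≡⟨ ∣m+n-m+o∣≡∣n-o∣ (n % d) (m / d * d) (n / d * d) ⟩
  ∣ m / d * d - n / d * d ∣                   ≡⟨ sym (*-distribʳ-∣-∣ d (m / d) (n / d)) ⟩
  ∣ m / d - n / d ∣ * d                       ∎)
  where open ≡-Reasoning

∣m⊖n∣≡∣m-n∣ : ∀ m n → ℤ.∣ m ⊖ n ∣ ≡ ∣ m - n ∣
∣m⊖n∣≡∣m-n∣ m n with ≤-total m n
... | inj₁ m≤n = trans (∣⊖∣-≤ m≤n) (sym (m≤n⇒∣m-n∣≡n∸m m≤n))
... | inj₂ n≤m = trans (∣m⊖n∣≡∣n⊖m∣ m n) (trans (∣⊖∣-≤ n≤m) (sym (m≤n⇒∣n-m∣≡n∸m n≤m)))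

%-≡⇒∣[+m]-[+n] : ∀ m n d .{{_ : NonZero d}} → m % d ≡ n % d → + d ∣ + m - + n
%-≡⇒∣[+m]-[+n] m n d m%d≡n%d =
  subst (d ℕ.∣_) (sym (trans (cong ℤ.∣_∣ ([+m]-[+n]≡m⊖n m n)) (∣m⊖n∣≡∣m-n∣ m n)))
    (%-≡⇒∣∣-∣ m n d m%d≡n%d)

proposition2p1 : (a b c d : ℕ) → a ^ 5 + b ^ 5 ≡ c ^ 5 + d ^ 5 →
    (+ 30) ∣ ((+ (c + d)) - (+ (a + b)))
proposition2p1 a b c d a⁵+b⁵≡c⁵+d⁵ = %-≡⇒∣[+m]-[+n] (c + d) (a + b) 30 (begin
  (c + d) % 30          ≡⟨ sym ([m^5+n^5]%30≡[m+n]%30 c d) ⟩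
  (c ^ 5 + d ^ 5) % 30  ≡⟨ cong (_% 30) (sym a⁵+b⁵≡c⁵+d⁵) ⟩
  (a ^ 5 + b ^ 5) % 30  ≡⟨ [m^5+n^5]%30≡[m+n]%30 a b ⟩
  (a + b) % 30          ∎)
  where open ≡-Reasoning
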